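{- Let $r\ge 3$ and $s\ge r+1$ be constant integers, let $\ell=s-r$, and let $p\in(0,1]$ be a constant. Let $G=G^r(n,p)$ on vertex set $[n]$, and let $Q_1,\dots,Q_{\lfloor n/\ell\rfloor}$ be fixed pairwise disjoint subsets of $[n]$, each of size $\ell$. Let $k\ge 0$ be a constant integer. Then, with high probability, for every $S\subseteq [n]$ with $|S|=k$ there exists $i\in\{1,\dots,\lfloor n/\ell\rfloor\}$ such that $S\cap Q_i=\varnothing$ and every $r$-set $e\subseteq Q_i\cup S$ with $e\cap Q_i\neq\varnothing$ is an edge of $G$.
   Context: $G^r(n,p)$ is the binomial random $r$-uniform hypergraph on $[n]$: each $r$-subset of $[n]$ is an edge independently with probability $p$. "With high probability" means with probability tending to $1$ as $n\to\infty$.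
   Formalization: The constant $p\in(0,1]$ ranges only over rational numbers. -}

module Defs where

open import Data.Bool using (Bool; true; false; _∧_; _∨_; not; if_then_else_)
open import Data.Nat using (ℕ; zero; suc; _≡ᵇ_)
open import Data.Nat.DivMod using (_/_)
open import Data.Fin using (Fin)
open import Data.Vec using (Vec; []; _∷_)
open import Data.List using (List; []; _∷_; map; _++_; filterᵇ; foldr)
open import Data.Product using (_×_; _,_; proj₁; proj₂)
open import Data.Rational using (ℚ; 0ℚ; 1ℚ; _+_; _*_; _-_)
open import Data.Fin.Subset using (Subset; ∣_∣; _∩_; _∪_) public

any : ∀ {A : Set} → (A → Bool) → List A → Bool
any f [] = false
any f (x ∷ xs) = f x ∨ any f xs

all : ∀ {A : Set} → (A → Bool) → List A → Bool
all f [] = true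
all f (x ∷ xs) = f x ∧ all f xs

_⊆ᵇ_ : ∀ {n} → Subset n → Subset n → Bool
[] ⊆ᵇ [] = true
(a ∷ as) ⊆ᵇ (b ∷ bs) = (not a ∨ b) ∧ (as ⊆ᵇ bs)

_≡ˢ_ : ∀ {n} → Subset n → Subset n → Bool
A ≡ˢ B = (A ⊆ᵇ B) ∧ (B ⊆ᵇ A)

isEmptyᵇ : ∀ {n} → Subset n → Bool
isEmptyᵇ [] = true
isEmptyᵇ (a ∷ as) = not a ∧ isEmptyᵇ as

disjointᵇ : ∀ {n} → Subset n → Subset n → Bool
disjointᵇ A B = isEmptyᵇ (A ∩ B)

elemᵇ : ∀ {n} → Subset n → List (Subset n) → Bool
elemᵇ A = any (λ B → A ≡ˢ B)

allSubsets : (n : ℕ) → List (Subset n)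
allSubsets zero = [] ∷ []
allSubsets (suc n) = map (true ∷_) (allSubsets n) ++ map (false ∷_) (allSubsets n)

kSubsets : (n k : ℕ) → List (Subset n)
kSubsets n k = filterᵇ (λ A → ∣ A ∣ ≡ᵇ k) (allSubsets n)

-- The binomial random r-uniform hypergraph G^r(n,p) as an explicit
-- finite probability space: an outcome is the list of chosen edges,
-- with weight p^{#chosen} (1-p)^{#not chosen}; each r-subset is
-- included independently with probability p.

outcomes : ∀ {n} → ℚ → List (Subset n) → List (List (Subset n) × ℚ)
outcomes p [] = ([] , 1ℚ) ∷ []
outcomes p (e ∷ es) =
  map (λ o → (e ∷ proj₁ o) , (p * proj₂ o)) (outcomes p es)
  ++ map (λ o → proj₁ o , ((1ℚ - p) * proj₂ o)) (outcomes p es)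

Prob : (n r : ℕ) (p : ℚ) → (List (Subset n) → Bool) → ℚ
Prob n r p P =
  foldr (λ o acc → (if P (proj₁ o) then proj₂ o else 0ℚ) + acc) 0ℚ
        (outcomes p (kSubsets n r))

allFinᵇ : (m : ℕ) → (Fin m → Bool) → Bool
allFinᵇ zero f = true
allFinᵇ (suc m) f = f Fin.zero ∧ allFinᵇ m (λ i → f (Fin.suc i))

anyFinᵇ : (m : ℕ) → (Fin m → Bool) → Bool
anyFinᵇ zero f = false
anyFinᵇ (suc m) f = f Fin.zero ∨ anyFinᵇ m (λ i → f (Fin.suc i))

goodEvent : (n r k m : ℕ) → (Fin m → Subset n) → List (Subset n) → Bool
goodEvent n r k m Q E =
  all (λ S →
    anyFinᵇ m (λ i →
      disjointᵇ S (Q i) ∧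
      all (λ e → if (e ⊆ᵇ (Q i ∪ S)) ∧ not (disjointᵇ e (Q i))
                 then elemᵇ e E else true)
          (kSubsets n r)))
  (kSubsets n k)

{-# OPTIONS --safe #-}
module Submission where

-- Fix S with |S| = k. At least ⌊n/ℓ⌋ − k of the blocks Qᵢ avoid S, and for such a block the r-sets
-- that have to be edges lie in Qᵢ ∪ S, so there are at most 2^(ℓ+k) of them and they are all present
-- with probability at least q = p^(2^(ℓ+k)). Different blocks require disjoint sets of r-sets, so
-- these events are independent and all of them fail with probability at most (1 − q)^(⌊n/ℓ⌋ − k).
-- A union bound over the at most (n+1)^k sets S bounds the failure probability by
-- (n+1)^k (1 − q)^(⌊n/ℓ⌋ − k), which tends to 0.

open import Defs

module Rationals where
  open import Algebra.Bundles using (CommutativeRing)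
  open import Data.Bool using (Bool; true; false)
  open import Data.Fin using (Fin; zero; suc)
  open import Data.Integer as ℤ using (+_; +[1+_]; -[1+_])
  import Data.Integer.Properties as ℤ
  open import Data.Nat as ℕ using (ℕ; zero; suc)
  import Data.Nat.Properties as ℕ
  import Data.Nat.Coprimality as Coprime
  open import Data.Product using (∃-syntax; _,_)
  open import Data.Rational hiding (∣_∣)
  open import Data.Rational.Properties
  import Data.Rational.Unnormalised as ℚᵘ
  import Data.Rational.Unnormalised.Properties as ℚᵘ
  open import Data.Vec using (tabulate)
  open import Function using (_∘_)
  open import Relation.Binary.PropositionalEquality
  open CommutativeRing +-*-commutativeRing using (commutativeSemiring; semiring)
  open import Algebra.Properties.CommutativeSemiring.Exp commutativeSemiring public
    using (_^_; ^-distrib-*)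
  open import Algebra.Properties.Semiring.Mult semiring using (_×_; ×1-homo-*)
  open import Algebra.Definitions.RawMonoid *-1-rawMonoid public using () renaming (sum to ∏)

  0≤1 : 0ℚ ≤ 1ℚ
  0≤1 = ≤ᵇ⇒≤ _

  p≤1⇒0≤1-p : ∀ {p} → p ≤ 1ℚ → 0ℚ ≤ 1ℚ - p
  p≤1⇒0≤1-p {p} p≤1 = subst (_≤ 1ℚ - p) (+-inverseʳ p) (+-monoˡ-≤ (- p) p≤1)

  0≤p⇒1-p≤1 : ∀ {p} → 0ℚ ≤ p → 1ℚ - p ≤ 1ℚ
  0≤p⇒1-p≤1 {p} 0≤p = subst (1ℚ - p ≤_) (+-identityʳ 1ℚ) (+-monoʳ-≤ 1ℚ (neg-antimono-≤ 0≤p))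

  *-nonNeg : ∀ {a b} → 0ℚ ≤ a → 0ℚ ≤ b → 0ℚ ≤ a * b
  *-nonNeg {a} {b} 0≤a 0≤b =
    nonNegative⁻¹ _ {{nonNeg*nonNeg⇒nonNeg a {{nonNegative 0≤a}} b {{nonNegative 0≤b}}}}

  *-mono-≤-nonNeg : ∀ {a a′ b b′} → 0ℚ ≤ a → a ≤ a′ → 0ℚ ≤ b → b ≤ b′ → a * b ≤ a′ * b′
  *-mono-≤-nonNeg {a} {a′} {b} {b′} 0≤a a≤a′ 0≤b b≤b′ = ≤-trans
    (*-monoʳ-≤-nonNeg b {{nonNegative 0≤b}} a≤a′)
    (*-monoˡ-≤-nonNeg a′ {{nonNegative (≤-trans 0≤a a≤a′)}} b≤b′)

  ^-nonNeg : ∀ {x} n → 0ℚ ≤ x → 0ℚ ≤ x ^ n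
  ^-nonNeg zero    0≤x = 0≤1
  ^-nonNeg (suc n) 0≤x = *-nonNeg 0≤x (^-nonNeg n 0≤x)

  ^-pos : ∀ {x} n → 0ℚ < x → 0ℚ < x ^ n
  ^-pos zero        0<x = positive⁻¹ 1ℚ
  ^-pos {x} (suc n) 0<x =
    positive⁻¹ _ {{pos*pos⇒pos x {{positive 0<x}} (x ^ n) {{positive (^-pos n 0<x)}}}}

  ^-≤1 : ∀ {x} n → 0ℚ ≤ x → x ≤ 1ℚ → x ^ n ≤ 1ℚ
  ^-≤1 zero    0≤x x≤1 = ≤-refl
  ^-≤1 (suc n) 0≤x x≤1 = *-mono-≤-nonNeg 0≤x x≤1 (^-nonNeg n 0≤x) (^-≤1 n 0≤x x≤1)

  ^-monoˡ-≤ : ∀ {x y} n → 0ℚ ≤ x → x ≤ y → x ^ n ≤ y ^ n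
  ^-monoˡ-≤ zero    0≤x x≤y = ≤-refl
  ^-monoˡ-≤ (suc n) 0≤x x≤y = *-mono-≤-nonNeg 0≤x x≤y (^-nonNeg n 0≤x) (^-monoˡ-≤ n 0≤x x≤y)

  ^-antitoneʳ-≤ : ∀ {x m n} → 0ℚ ≤ x → x ≤ 1ℚ → m ℕ.≤ n → x ^ n ≤ x ^ m
  ^-antitoneʳ-≤ {n = n} 0≤x x≤1 ℕ.z≤n      = ^-≤1 n 0≤x x≤1
  ^-antitoneʳ-≤ {x}     0≤x x≤1 (ℕ.s≤s m≤n) =
    *-monoˡ-≤-nonNeg x {{nonNegative 0≤x}} (^-antitoneʳ-≤ 0≤x x≤1 m≤n)

  ∏-nonNeg : ∀ m (x : Fin m → ℚ) → (∀ i → 0ℚ ≤ x i) → 0ℚ ≤ ∏ x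
  ∏-nonNeg zero    x 0≤x = 0≤1
  ∏-nonNeg (suc m) x 0≤x = *-nonNeg (0≤x zero) (∏-nonNeg m (x ∘ suc) (0≤x ∘ suc))

  ∏-≤-^ : ∀ m (x : Fin m → ℚ) (D : Fin m → Bool) {b} →
    (∀ i → 0ℚ ≤ x i) → (∀ i → x i ≤ 1ℚ) → (∀ i → D i ≡ true → x i ≤ b) →
    ∏ x ≤ b ^ ∣ tabulate D ∣
  ∏-≤-^ zero    x D 0≤x x≤1 x≤b = ≤-refl
  ∏-≤-^ (suc m) x D 0≤x x≤1 x≤b
    with D zero in D₀ | ∏-≤-^ m (x ∘ suc) (D ∘ suc) (0≤x ∘ suc) (x≤1 ∘ suc) (x≤b ∘ suc)
  ... | true  | tail≤ = *-mono-≤-nonNeg (0≤x zero) (x≤b zero D₀) (∏-nonNeg m (x ∘ suc) (0≤x ∘ suc)) tail≤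
  ... | false | tail≤ = subst (∏ x ≤_) (*-identityˡ _)
    (*-mono-≤-nonNeg (0≤x zero) (x≤1 zero) (∏-nonNeg m (x ∘ suc) (0≤x ∘ suc)) tail≤)

  fromℕ : ℕ → ℚ
  fromℕ n = n × 1ℚ

  fromℕ-* : ∀ m n → fromℕ (m ℕ.* n) ≡ fromℕ m * fromℕ n
  fromℕ-* = ×1-homo-*

  fromℕ-^ : ∀ m k → fromℕ (m ℕ.^ k) ≡ fromℕ m ^ k
  fromℕ-^ m zero    = refl
  fromℕ-^ m (suc k) = trans (fromℕ-* m (m ℕ.^ k)) (cong (fromℕ m *_) (fromℕ-^ m k))

  fromℕ-nonNeg : ∀ n → 0ℚ ≤ fromℕ n
  fromℕ-nonNeg zero    = ≤-refl
  fromℕ-nonNeg (suc n) = +-mono-≤ 0≤1 (fromℕ-nonNeg n)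

  fromℕ-pos : ∀ n .{{_ : ℕ.NonZero n}} → 0ℚ < fromℕ n
  fromℕ-pos (suc n) = +-mono-<-≤ (positive⁻¹ 1ℚ) (fromℕ-nonNeg n)

  fromℕ-mono-≤ : ∀ {m n} → m ℕ.≤ n → fromℕ m ≤ fromℕ n
  fromℕ-mono-≤ {n = n} ℕ.z≤n = fromℕ-nonNeg n
  fromℕ-mono-≤ (ℕ.s≤s m≤n)  = +-monoʳ-≤ 1ℚ (fromℕ-mono-≤ m≤n)

  _/1 : ℕ → ℚ
  k /1 = mkℚ (+ k) 0 (Coprime.sym (Coprime.1-coprimeTo k))

  fromℕ≡/1 : ∀ k → fromℕ k ≡ k /1
  fromℕ≡/1 zero    = refl
  fromℕ≡/1 (suc k) = trans (cong (λ y → 1ℚ + y) (fromℕ≡/1 k))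
    (toℚᵘ-injective (ℚᵘ.≃-trans (toℚᵘ-homo-+ 1ℚ (k /1)) (ℚᵘ.*≡* numerators)))
    where
    numerators : (+ 1 ℤ.* + 1 ℤ.+ + k ℤ.* + 1) ℤ.* + 1 ≡ + suc k ℤ.* (+ 1 ℤ.* + 1)
    numerators = trans (ℤ.*-identityʳ _)
      (trans (cong (ℤ._+_ (+ 1)) (ℤ.*-identityʳ (+ k))) (sym (ℤ.*-identityʳ _)))

  -- For x = (1 + a)/(1 + d) the witness 1 + d gives (1 + d)·x = 1 + a.
  archimedean : ∀ x → 0ℚ < x → ∃[ d ] 1ℚ ≤ fromℕ d * x
  archimedean (mkℚ (+ 0)      d _) (*<* (ℤ.+<+ ()))
  archimedean (mkℚ -[1+ a ]   d _) (*<* ())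
  archimedean x@(mkℚ +[1+ a ] d _) _ = suc d , subst (λ y → 1ℚ ≤ y * x) (sym (fromℕ≡/1 (suc d)))
    (toℚᵘ-cancel-≤ (ℚᵘ.≤-respʳ-≃ (ℚᵘ.≃-sym (toℚᵘ-homo-* (suc d /1) x))
                                  (ℚᵘ.*≤* (ℤ.+≤+ denominator≤numerator))))
    where
    denominator≤numerator : 1 ℕ.* suc (d ℕ.+ 0) ℕ.≤ (suc d ℕ.* suc a) ℕ.* 1
    denominator≤numerator = subst₂ ℕ._≤_ (sym (trans (ℕ.*-identityˡ _) (cong suc (ℕ.+-identityʳ d))))
      (sym (ℕ.*-identityʳ _)) (ℕ.m≤m*n (suc d) (suc a))

module Probability where
  open import Data.Bool using (Bool; true; false; not; _∧_; _∨_; if_then_else_)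
  open import Data.Bool.Properties using (∧-comm)
  open import Data.Fin using (Fin; zero; suc)
  open import Data.Fin.Properties using (suc-injective)
  open import Data.List using (List; []; _∷_; _++_; map; foldr; length)
  open import Data.List.Relation.Unary.All using (All; []; _∷_)
  open import Data.Nat using (ℕ; zero; suc)
  open import Data.Product using (_×_; _,_; proj₁; proj₂)
  open import Data.Rational using (ℚ; 0ℚ; 1ℚ; _+_; _*_; _-_; _≤_; nonNegative)
  open import Data.Rational.Properties
  open import Data.Rational.Solver using (module +-*-Solver)
  open import Data.Sum as Sum using (_⊎_; inj₁; inj₂)
  open import Function using (_∘_)
  open import Relation.Binary.PropositionalEquality
  open Rationals
  open +-*-Solver

  Event : ℕ → Set
  Event n = List (Subset n) → Bool

  mix : ℚ → ℚ → ℚ → ℚ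
  mix p a b = p * a + (1ℚ - p) * b

  mix-idem : ∀ p a → mix p a a ≡ a
  mix-idem = solve 2 (λ p a → p :* a :+ (con 1ℚ :- p) :* a := a) refl

  mix-mono-≤ : ∀ {p a a′ b b′} → 0ℚ ≤ p → p ≤ 1ℚ → a ≤ a′ → b ≤ b′ → mix p a b ≤ mix p a′ b′
  mix-mono-≤ {p} 0≤p p≤1 a≤a′ b≤b′ = +-mono-≤
    (*-monoˡ-≤-nonNeg p {{nonNegative 0≤p}} a≤a′)
    (*-monoˡ-≤-nonNeg (1ℚ - p) {{nonNegative (p≤1⇒0≤1-p p≤1)}} b≤b′)

  mix-≥ : ∀ {p a b c} → 0ℚ ≤ p → p ≤ 1ℚ → c ≤ a → c ≤ b → c ≤ mix p a b
  mix-≥ {p} {c = c} 0≤p p≤1 c≤a c≤b = subst (_≤ _) (mix-idem p c) (mix-mono-≤ 0≤p p≤1 c≤a c≤b)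

  mix-≤ : ∀ {p a b c} → 0ℚ ≤ p → p ≤ 1ℚ → a ≤ c → b ≤ c → mix p a b ≤ c
  mix-≤ {p} {c = c} 0≤p p≤1 a≤c b≤c = subst (_ ≤_) (mix-idem p c) (mix-mono-≤ 0≤p p≤1 a≤c b≤c)

  weight : ∀ {n} → Event n → List (Subset n) × ℚ → ℚ
  weight P o = if P (proj₁ o) then proj₂ o else 0ℚ

  mass : ∀ {n} → Event n → List (List (Subset n) × ℚ) → ℚ
  mass P = foldr (λ o acc → weight P o + acc) 0ℚ

  Pr : ∀ {n} → ℚ → List (Subset n) → Event n → ℚ
  Pr p es P = mass P (outcomes p es)

  mass-cong : ∀ {n} {P P′ : Event n} → (∀ E → P E ≡ P′ E) → ∀ os → mass P os ≡ mass P′ os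
  mass-cong P≗P′ []       = refl
  mass-cong P≗P′ (o ∷ os) =
    cong₂ (λ b m → (if b then proj₂ o else 0ℚ) + m) (P≗P′ (proj₁ o)) (mass-cong P≗P′ os)

  mass-++ : ∀ {n} (P : Event n) os os′ → mass P (os ++ os′) ≡ mass P os + mass P os′
  mass-++ P []       os′ = sym (+-identityˡ _)
  mass-++ P (o ∷ os) os′ = trans (cong (weight P o +_) (mass-++ P os os′))
                                 (sym (+-assoc (weight P o) (mass P os) (mass P os′)))

  mass-scale : ∀ {n} (P : Event n) (f : List (Subset n) → List (Subset n)) c os →
    mass P (map (λ o → f (proj₁ o) , c * proj₂ o) os) ≡ c * mass (P ∘ f) os
  mass-scale P f c []       = sym (*-zeroʳ c)
  mass-scale P f c (o ∷ os) with P (f (proj₁ o))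
  ... | true  = trans (cong (c * proj₂ o +_) (mass-scale P f c os))
                      (sym (*-distribˡ-+ c (proj₂ o) (mass (P ∘ f) os)))
  ... | false = trans (cong₂ _+_ (sym (*-zeroʳ c)) (mass-scale P f c os))
                      (sym (*-distribˡ-+ c 0ℚ (mass (P ∘ f) os)))

  -- Conditioning on the first candidate edge; all properties of Pr below follow from this recursion.
  Pr-∷ : ∀ {n} p (e : Subset n) es P → Pr p (e ∷ es) P ≡ mix p (Pr p es (P ∘ (e ∷_))) (Pr p es P)
  Pr-∷ p e es P = trans
    (mass-++ P (map (λ o → (e ∷ proj₁ o) , p * proj₂ o) (outcomes p es))
               (map (λ o → proj₁ o , (1ℚ - p) * proj₂ o) (outcomes p es)))
    (cong₂ _+_ (mass-scale P (e ∷_) p (outcomes p es)) (mass-scale P (λ E → E) (1ℚ - p) (outcomes p es)))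

  Pr-cong : ∀ {n} p es {P P′ : Event n} → (∀ E → P E ≡ P′ E) → Pr p es P ≡ Pr p es P′
  Pr-cong p es P≗P′ = mass-cong P≗P′ (outcomes p es)

  Ignores : ∀ {n} → Event n → Subset n → Set
  Ignores P x = ∀ E₁ E₂ → P (E₁ ++ x ∷ E₂) ≡ P (E₁ ++ E₂)

  Ignores-∷ : ∀ {n} {P : Event n} {x} e → Ignores P x → Ignores (P ∘ (e ∷_)) x
  Ignores-∷ e ign E₁ = ign (e ∷ E₁)

  Ignores-allFin : ∀ {n} m (X : Fin m → Event n) {x} →
    (∀ i → Ignores (X i) x) → Ignores (λ E → allFinᵇ m (λ i → X i E)) x
  Ignores-allFin zero    X ign E₁ E₂ = refl
  Ignores-allFin (suc m) X ign E₁ E₂ =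
    cong₂ _∧_ (ign zero E₁ E₂) (Ignores-allFin m (X ∘ suc) (ign ∘ suc) E₁ E₂)

  module _ {n : ℕ} (p : ℚ) where

    Pr-false : ∀ (es : List (Subset n)) → Pr p es (λ _ → false) ≡ 0ℚ
    Pr-false []       = refl
    Pr-false (e ∷ es) = trans (Pr-∷ p e es (λ _ → false))
      (trans (cong (λ x → mix p x x) (Pr-false es)) (mix-idem p 0ℚ))

    Pr-+-Pr-not : ∀ es (P : Event n) → Pr p es P + Pr p es (not ∘ P) ≡ 1ℚ
    Pr-+-Pr-not [] P with P []
    ... | true  = refl
    ... | false = refl
    Pr-+-Pr-not (e ∷ es) P = begin
      Pr p (e ∷ es) P + Pr p (e ∷ es) (not ∘ P)
        ≡⟨ cong₂ _+_ (Pr-∷ p e es P) (Pr-∷ p e es (not ∘ P)) ⟩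
      mix p a b + mix p a′ b′
        ≡⟨ solve 5 (λ p a b a′ b′ → (p :* a :+ (con 1ℚ :- p) :* b) :+ (p :* a′ :+ (con 1ℚ :- p) :* b′)
                                    := p :* (a :+ a′) :+ (con 1ℚ :- p) :* (b :+ b′)) refl p a b a′ b′ ⟩
      mix p (a + a′) (b + b′)
        ≡⟨ cong₂ (mix p) (Pr-+-Pr-not es (P ∘ (e ∷_))) (Pr-+-Pr-not es P) ⟩
      mix p 1ℚ 1ℚ
        ≡⟨ mix-idem p 1ℚ ⟩
      1ℚ ∎
      where
      open ≡-Reasoning
      a  = Pr p es (P ∘ (e ∷_))
      a′ = Pr p es (not ∘ P ∘ (e ∷_))
      b  = Pr p es P
      b′ = Pr p es (not ∘ P)

    Pr-true : ∀ (es : List (Subset n)) → Pr p es (λ _ → true) ≡ 1ℚ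
    Pr-true es = begin
      Pr p es (λ _ → true)                          ≡⟨ sym (+-identityˡ _) ⟩
      0ℚ + Pr p es (λ _ → true)                     ≡⟨ cong (_+ Pr p es (λ _ → true)) (sym (Pr-false es)) ⟩
      Pr p es (λ _ → false) + Pr p es (λ _ → true)  ≡⟨ Pr-+-Pr-not es (λ _ → false) ⟩
      1ℚ                                            ∎
      where open ≡-Reasoning

    Pr-not : ∀ es (P : Event n) → Pr p es (not ∘ P) ≡ 1ℚ - Pr p es P
    Pr-not es P = trans (solve 2 (λ a b → b := (a :+ b) :- a) refl (Pr p es P) (Pr p es (not ∘ P)))
                        (cong (_- Pr p es P) (Pr-+-Pr-not es P))

    Pr[¬P]≤ε⇒1-ε≤Pr[P] : ∀ es (P : Event n) {ε} → Pr p es (not ∘ P) ≤ ε → 1ℚ - ε ≤ Pr p es P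
    Pr[¬P]≤ε⇒1-ε≤Pr[P] es P {ε} failure≤ε =
      subst (1ℚ - ε ≤_) 1-Pr[¬P]≡Pr[P] (+-monoʳ-≤ 1ℚ (neg-antimono-≤ failure≤ε))
      where
      1-Pr[¬P]≡Pr[P] : 1ℚ - Pr p es (not ∘ P) ≡ Pr p es P
      1-Pr[¬P]≡Pr[P] = trans (cong (_- Pr p es (not ∘ P)) (sym (Pr-+-Pr-not es P)))
        (solve 2 (λ a b → (a :+ b) :- b := a) refl (Pr p es P) (Pr p es (not ∘ P)))

    Pr-∷-ignored : ∀ e es {P : Event n} → Ignores P e → Pr p (e ∷ es) P ≡ Pr p es P
    Pr-∷-ignored e es {P} ign = trans (Pr-∷ p e es P)
      (trans (cong (λ x → mix p x (Pr p es P)) (Pr-cong p es (ign []))) (mix-idem p (Pr p es P)))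

    Independent : Event n → Event n → List (Subset n) → Set
    Independent P P′ es = Pr p es (λ E → P E ∧ P′ E) ≡ Pr p es P * Pr p es P′

    Independent-sym : ∀ P P′ es → Independent P P′ es → Independent P′ P es
    Independent-sym P P′ es indep =
      trans (Pr-cong p es (λ E → ∧-comm (P′ E) (P E))) (trans indep (*-comm (Pr p es P) (Pr p es P′)))

    Independent-∷ : ∀ e es (P P′ : Event n) → Ignores P′ e →
      Independent (P ∘ (e ∷_)) P′ es → Independent P P′ es → Independent P P′ (e ∷ es)
    Independent-∷ e es P P′ ign indep₁ indep₂ = begin
      Pr p (e ∷ es) (λ E → P E ∧ P′ E)
        ≡⟨ Pr-∷ p e es (λ E → P E ∧ P′ E) ⟩
      mix p (Pr p es (λ E → P (e ∷ E) ∧ P′ (e ∷ E))) (Pr p es (λ E → P E ∧ P′ E))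
        ≡⟨ cong₂ (mix p) (trans (Pr-cong p es (λ E → cong (P (e ∷ E) ∧_) (ign [] E))) indep₁) indep₂ ⟩
      mix p (a * c) (b * c)
        ≡⟨ solve 4 (λ p a b c → p :* (a :* c) :+ (con 1ℚ :- p) :* (b :* c)
                                := (p :* a :+ (con 1ℚ :- p) :* b) :* c) refl p a b c ⟩
      mix p a b * c
        ≡⟨ cong₂ _*_ (sym (Pr-∷ p e es P)) (sym (Pr-∷-ignored e es {P′} ign)) ⟩
      Pr p (e ∷ es) P * Pr p (e ∷ es) P′ ∎
      where
      open ≡-Reasoning
      a = Pr p es (P ∘ (e ∷_))
      b = Pr p es P
      c = Pr p es P′

    Pr-∧-independent : ∀ es (P P′ : Event n) → (∀ x → Ignores P x ⊎ Ignores P′ x) → Independent P P′ es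
    Pr-∧-independent [] P P′ _ with P [] | P′ []
    ... | true  | true  = refl
    ... | true  | false = refl
    ... | false | true  = refl
    ... | false | false = refl
    Pr-∧-independent (e ∷ es) P P′ split with split e
    ... | inj₂ ign = Independent-∷ e es P P′ ign
      (Pr-∧-independent es (P ∘ (e ∷_)) P′ (Sum.map₁ (Ignores-∷ {P = P} e) ∘ split))
      (Pr-∧-independent es P P′ split)
    ... | inj₁ ign = Independent-sym P′ P (e ∷ es) (Independent-∷ e es P′ P ign
      (Independent-sym P (P′ ∘ (e ∷_)) es
        (Pr-∧-independent es P (P′ ∘ (e ∷_)) (Sum.map₂ (Ignores-∷ {P = P′} e) ∘ split)))
      (Independent-sym P P′ es (Pr-∧-independent es P P′ split)))

    Pr-allFin-independent : ∀ es m (X : Fin m → Event n) (support : Fin m → Subset n → Bool) →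
      (∀ i x → support i x ≡ false → Ignores (X i) x) →
      (∀ i j x → i ≢ j → support i x ≡ true → support j x ≡ false) →
      Pr p es (λ E → allFinᵇ m (λ i → X i E)) ≡ ∏ (λ i → Pr p es (X i))
    Pr-allFin-independent es zero    X support outside disjoint = Pr-true es
    Pr-allFin-independent es (suc m) X support outside disjoint = trans
      (Pr-∧-independent es (X zero) rest split)
      (cong (Pr p es (X zero) *_) (Pr-allFin-independent es m (X ∘ suc) (support ∘ suc)
        (outside ∘ suc) (λ i j x i≢j → disjoint (suc i) (suc j) x (i≢j ∘ suc-injective))))
      where
      rest : Event n
      rest E = allFinᵇ m (λ i → X (suc i) E)
      split : ∀ x → Ignores (X zero) x ⊎ Ignores rest x
      split x with support zero x in x∈support₀
      ... | false = inj₁ (outside zero x x∈support₀)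
      ... | true  = inj₂ (Ignores-allFin m (X ∘ suc)
                           (λ j → outside (suc j) x (disjoint zero (suc j) x (λ ()) x∈support₀)))

  module _ {n : ℕ} {p : ℚ} (0≤p : 0ℚ ≤ p) (p≤1 : p ≤ 1ℚ) where

    Pr-nonNeg : ∀ es (P : Event n) → 0ℚ ≤ Pr p es P
    Pr-nonNeg [] P with P []
    ... | true  = 0≤1
    ... | false = ≤-refl
    Pr-nonNeg (e ∷ es) P =
      subst (0ℚ ≤_) (sym (Pr-∷ p e es P)) (mix-≥ 0≤p p≤1 (Pr-nonNeg es (P ∘ (e ∷_))) (Pr-nonNeg es P))

    Pr-≤1 : ∀ es (P : Event n) → Pr p es P ≤ 1ℚ
    Pr-≤1 [] P with P []
    ... | true  = ≤-refl
    ... | false = 0≤1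
    Pr-≤1 (e ∷ es) P =
      subst (_≤ 1ℚ) (sym (Pr-∷ p e es P)) (mix-≤ 0≤p p≤1 (Pr-≤1 es (P ∘ (e ∷_))) (Pr-≤1 es P))

    Pr-mono : ∀ es (P P′ : Event n) → (∀ E → P E ≡ true → P′ E ≡ true) → Pr p es P ≤ Pr p es P′
    Pr-mono [] P P′ P⇒P′ with P [] | P⇒P′ []
    ... | true  | P′[]≡true rewrite P′[]≡true refl = ≤-refl
    ... | false | _                               = Pr-nonNeg [] P′
    Pr-mono (e ∷ es) P P′ P⇒P′ = subst₂ _≤_ (sym (Pr-∷ p e es P)) (sym (Pr-∷ p e es P′))
      (mix-mono-≤ 0≤p p≤1 (Pr-mono es (P ∘ (e ∷_)) (P′ ∘ (e ∷_)) (P⇒P′ ∘ (e ∷_))) (Pr-mono es P P′ P⇒P′))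

    Pr-∨-≤ : ∀ es (P P′ : Event n) → Pr p es (λ E → P E ∨ P′ E) ≤ Pr p es P + Pr p es P′
    Pr-∨-≤ [] P P′ with P [] | P′ []
    ... | true  | true  = ≤ᵇ⇒≤ _
    ... | true  | false = ≤-refl
    ... | false | true  = ≤-refl
    ... | false | false = ≤-refl
    Pr-∨-≤ (e ∷ es) P P′ = begin
      Pr p (e ∷ es) (λ E → P E ∨ P′ E)
        ≡⟨ Pr-∷ p e es (λ E → P E ∨ P′ E) ⟩
      mix p (Pr p es (λ E → P (e ∷ E) ∨ P′ (e ∷ E))) (Pr p es (λ E → P E ∨ P′ E))
        ≤⟨ mix-mono-≤ 0≤p p≤1 (Pr-∨-≤ es (P ∘ (e ∷_)) (P′ ∘ (e ∷_))) (Pr-∨-≤ es P P′) ⟩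
      mix p (a + a′) (b + b′)
        ≡⟨ solve 5 (λ p a b a′ b′ → p :* (a :+ a′) :+ (con 1ℚ :- p) :* (b :+ b′)
                      := (p :* a :+ (con 1ℚ :- p) :* b) :+ (p :* a′ :+ (con 1ℚ :- p) :* b′)) refl p a b a′ b′ ⟩
      mix p a b + mix p a′ b′
        ≡⟨ sym (cong₂ _+_ (Pr-∷ p e es P) (Pr-∷ p e es P′)) ⟩
      Pr p (e ∷ es) P + Pr p (e ∷ es) P′ ∎
      where
      open ≤-Reasoning
      a  = Pr p es (P ∘ (e ∷_))
      a′ = Pr p es (P′ ∘ (e ∷_))
      b  = Pr p es P
      b′ = Pr p es P′

    Pr-not-all-≤ : ∀ {A : Set} es (f : A → Event n) (Ss : List A) {b} →
      All (λ S → Pr p es (not ∘ f S) ≤ b) Ss →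
      Pr p es (λ E → not (all (λ S → f S E) Ss)) ≤ fromℕ (length Ss) * b
    Pr-not-all-≤ es f [] {b} [] = ≤-reflexive (trans (Pr-false p es) (sym (*-zeroˡ b)))
    Pr-not-all-≤ es f (S ∷ Ss) {b} (bound ∷ bounds) = begin
      Pr p es (λ E → not (f S E ∧ rest E))
        ≡⟨ Pr-cong p es (λ E → not-∧ (f S E) (rest E)) ⟩
      Pr p es (λ E → not (f S E) ∨ not (rest E))
        ≤⟨ Pr-∨-≤ es (not ∘ f S) (not ∘ rest) ⟩
      Pr p es (not ∘ f S) + Pr p es (not ∘ rest)
        ≤⟨ +-mono-≤ bound (Pr-not-all-≤ es f Ss bounds) ⟩
      b + fromℕ (length Ss) * b
        ≡⟨ solve 2 (λ b m → b :+ m :* b := (con 1ℚ :+ m) :* b) refl b (fromℕ (length Ss)) ⟩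
      fromℕ (suc (length Ss)) * b ∎
      where
      open ≤-Reasoning
      rest : Event n
      rest E = all (λ S → f S E) Ss
      not-∧ : ∀ x y → not (x ∧ y) ≡ not x ∨ not y
      not-∧ true  y = refl
      not-∧ false y = refl

module BooleanSubsets where
  open import Data.Bool using (true; false; not; _∧_)
  open import Data.Bool.Properties using (∧-conicalʳ)
  open import Data.Fin using (Fin; zero; suc)
  open import Data.Fin.Properties using (suc-injective)
  open import Data.Fin.Subset using (_─_; Nonempty)
  open import Data.Fin.Subset.Properties using (p∩q≢∅⇒∣p─q∣<∣p∣)
  open import Data.Nat using (zero; suc; _≤_; _+_; z≤n; s≤s)
  open import Data.Nat.Properties using (≤-trans; ≤-reflexive; +-suc; +-monoʳ-≤; n≤1+n; module ≤-Reasoning)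
  open import Data.Product using (_,_)
  open import Data.Vec using ([]; _∷_; tabulate; here; there)
  open import Data.Vec.Properties using (tabulate-cong)
  open import Function using (_∘_)
  open import Relation.Binary.PropositionalEquality

  ≡ˢ-refl : ∀ {n} (A : Subset n) → (A ≡ˢ A) ≡ true
  ≡ˢ-refl A = cong₂ _∧_ (⊆ᵇ-refl A) (⊆ᵇ-refl A)
    where
    ⊆ᵇ-refl : ∀ {n} (A : Subset n) → (A ⊆ᵇ A) ≡ true
    ⊆ᵇ-refl []          = refl
    ⊆ᵇ-refl (true ∷ A)  = ⊆ᵇ-refl A
    ⊆ᵇ-refl (false ∷ A) = ⊆ᵇ-refl A

  ≡ˢ⇒≡ : ∀ {n} (A B : Subset n) → (A ≡ˢ B) ≡ true → A ≡ B
  ≡ˢ⇒≡ []          []          _   = refl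
  ≡ˢ⇒≡ (true ∷ A)  (true ∷ B)  A≡B = cong (true ∷_) (≡ˢ⇒≡ A B A≡B)
  ≡ˢ⇒≡ (false ∷ A) (false ∷ B) A≡B = cong (false ∷_) (≡ˢ⇒≡ A B A≡B)
  ≡ˢ⇒≡ (true ∷ A)  (false ∷ B) ()
  ≡ˢ⇒≡ (false ∷ A) (true ∷ B)  A≡B with ∧-conicalʳ (A ⊆ᵇ B) _ A≡B
  ... | ()

  ⊆ᵇ-∪-disjointᵇ : ∀ {n} (x A B C : Subset n) → (x ⊆ᵇ (B ∪ C)) ≡ true →
    disjointᵇ B A ≡ true → disjointᵇ C A ≡ true → disjointᵇ x A ≡ true
  ⊆ᵇ-∪-disjointᵇ []          []          []          []          _  _   _   = refl
  ⊆ᵇ-∪-disjointᵇ (false ∷ x) (a ∷ A)     (b ∷ B)     (c ∷ C)     x⊆ B#A C#A =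
    ⊆ᵇ-∪-disjointᵇ x A B C x⊆ (∧-conicalʳ _ _ B#A) (∧-conicalʳ _ _ C#A)
  ⊆ᵇ-∪-disjointᵇ (true ∷ x)  (false ∷ A) (b ∷ B)     (c ∷ C)     x⊆ B#A C#A =
    ⊆ᵇ-∪-disjointᵇ x A B C (∧-conicalʳ _ _ x⊆) (∧-conicalʳ _ _ B#A) (∧-conicalʳ _ _ C#A)
  ⊆ᵇ-∪-disjointᵇ (true ∷ x)  (true ∷ A)  (true ∷ B)  (c ∷ C)     x⊆ ()  C#A
  ⊆ᵇ-∪-disjointᵇ (true ∷ x)  (true ∷ A)  (false ∷ B) (true ∷ C)  x⊆ B#A ()
  ⊆ᵇ-∪-disjointᵇ (true ∷ x)  (true ∷ A)  (false ∷ B) (false ∷ C) () B#A C#A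

  disjointᵇ-─ : ∀ {n} (S A B : Subset n) → disjointᵇ A B ≡ true → disjointᵇ (S ─ A) B ≡ disjointᵇ S B
  disjointᵇ-─ []          []          []          _   = refl
  disjointᵇ-─ (s ∷ S)     (false ∷ A) (b ∷ B)     A#B = cong (not (s ∧ b) ∧_) (disjointᵇ-─ S A B A#B)
  disjointᵇ-─ (true ∷ S)  (true ∷ A)  (false ∷ B) A#B = disjointᵇ-─ S A B A#B
  disjointᵇ-─ (false ∷ S) (true ∷ A)  (false ∷ B) A#B = disjointᵇ-─ S A B A#B
  disjointᵇ-─ (s ∷ S)     (true ∷ A)  (true ∷ B)  ()

  disjointᵇ≡false⇒Nonempty : ∀ {n} (A B : Subset n) → disjointᵇ A B ≡ false → Nonempty (A ∩ B)
  disjointᵇ≡false⇒Nonempty []          []          ()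
  disjointᵇ≡false⇒Nonempty (true ∷ A)  (true ∷ B)  _ = zero , here
  disjointᵇ≡false⇒Nonempty (true ∷ A)  (false ∷ B) A∩B≢∅ with disjointᵇ≡false⇒Nonempty A B A∩B≢∅
  ... | i , i∈A∩B = suc i , there i∈A∩B
  disjointᵇ≡false⇒Nonempty (false ∷ A) (b ∷ B)     A∩B≢∅ with disjointᵇ≡false⇒Nonempty A B A∩B≢∅
  ... | i , i∈A∩B = suc i , there i∈A∩B

  ∣p∪q∣≤∣p∣+∣q∣ : ∀ {n} (A B : Subset n) → ∣ A ∪ B ∣ ≤ ∣ A ∣ + ∣ B ∣
  ∣p∪q∣≤∣p∣+∣q∣ []          []          = z≤n
  ∣p∪q∣≤∣p∣+∣q∣ (true ∷ A)  (true ∷ B)  = s≤s (≤-trans (∣p∪q∣≤∣p∣+∣q∣ A B) (+-monoʳ-≤ ∣ A ∣ (n≤1+n ∣ B ∣)))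
  ∣p∪q∣≤∣p∣+∣q∣ (true ∷ A)  (false ∷ B) = s≤s (∣p∪q∣≤∣p∣+∣q∣ A B)
  ∣p∪q∣≤∣p∣+∣q∣ (false ∷ A) (true ∷ B)  = ≤-trans (s≤s (∣p∪q∣≤∣p∣+∣q∣ A B)) (≤-reflexive (sym (+-suc ∣ A ∣ ∣ B ∣)))
  ∣p∪q∣≤∣p∣+∣q∣ (false ∷ A) (false ∷ B) = ∣p∪q∣≤∣p∣+∣q∣ A B

  PairwiseDisjoint : ∀ {n m} → (Fin m → Subset n) → Set
  PairwiseDisjoint Q = ∀ i j → i ≢ j → disjointᵇ (Q i) (Q j) ≡ true

  PairwiseDisjoint-∘suc : ∀ {n m} (Q : Fin (suc m) → Subset n) → PairwiseDisjoint Q → PairwiseDisjoint (Q ∘ suc)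
  PairwiseDisjoint-∘suc Q Q-disjoint i j i≢j = Q-disjoint (suc i) (suc j) (i≢j ∘ suc-injective)

  blocksAvoiding : ∀ {n m} → Subset n → (Fin m → Subset n) → Subset m
  blocksAvoiding S Q = tabulate (λ i → disjointᵇ S (Q i))

  -- Removing Q₀ from S keeps the other blocks' status and, if S meets Q₀, shrinks S.
  m≤∣blocksAvoiding∣+∣S∣ : ∀ {n} m (Q : Fin m → Subset n) → PairwiseDisjoint Q →
    ∀ S → m ≤ ∣ blocksAvoiding S Q ∣ + ∣ S ∣
  m≤∣blocksAvoiding∣+∣S∣ zero    Q Q-disjoint S = z≤n
  m≤∣blocksAvoiding∣+∣S∣ (suc m) Q Q-disjoint S with disjointᵇ S (Q zero) in S#Q₀
  ... | true  = s≤s (m≤∣blocksAvoiding∣+∣S∣ m (Q ∘ suc) (PairwiseDisjoint-∘suc Q Q-disjoint) S)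
  ... | false = begin
    suc m                                         ≤⟨ s≤s (m≤∣blocksAvoiding∣+∣S∣ m (Q ∘ suc)
                                                            (PairwiseDisjoint-∘suc Q Q-disjoint) S′) ⟩
    suc (∣ blocksAvoiding S′ (Q ∘ suc) ∣ + ∣ S′ ∣)  ≡⟨ cong (λ c → suc (c + ∣ S′ ∣)) same-blocks ⟩
    suc (c + ∣ S′ ∣)                              ≡⟨ sym (+-suc c ∣ S′ ∣) ⟩
    c + suc ∣ S′ ∣                                ≤⟨ +-monoʳ-≤ c S′-smaller ⟩
    c + ∣ S ∣                                     ∎
    where
    open ≤-Reasoning
    S′ = S ─ Q zero
    c = ∣ blocksAvoiding S (Q ∘ suc) ∣
    same-blocks : ∣ blocksAvoiding S′ (Q ∘ suc) ∣ ≡ c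
    same-blocks = cong ∣_∣ (tabulate-cong (λ i →
      disjointᵇ-─ S (Q zero) (Q (suc i)) (Q-disjoint zero (suc i) (λ ()))))
    S′-smaller : suc ∣ S′ ∣ ≤ ∣ S ∣
    S′-smaller = p∩q≢∅⇒∣p─q∣<∣p∣ S (Q zero) (disjointᵇ≡false⇒Nonempty S (Q zero) S#Q₀)

module SubsetCounting where
  open import Data.Bool using (Bool; true; false; T; T?)
  open import Data.List using (List; []; _∷_; _++_; map; length; filterᵇ)
  open import Data.List.Properties using (length-++; filter-++)
  open import Data.List.Relation.Binary.Sublist.Propositional.Properties using (filter-⊆; filter⁺; length-mono-≤)
  open import Data.List.Relation.Unary.All as All using (All)
  open import Data.List.Relation.Unary.All.Properties using (all-filter)
  open import Data.Nat using (zero; suc; _≤_; _+_; _^_; _≡ᵇ_; z≤n)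
  open import Data.Nat.Properties
    using (≡ᵇ⇒≡; ≤-refl; ≤-trans; ≤-reflexive; +-mono-≤; *-monoʳ-≤; ^-monoˡ-≤; n≤1+n; +-identityʳ;
           module ≤-Reasoning)
  open import Data.Vec using ([]; _∷_)
  open import Function using (_∘_)
  open import Relation.Binary.PropositionalEquality

  length-filterᵇ-map : ∀ {A B : Set} (f : B → Bool) (g : A → B) xs →
    length (filterᵇ f (map g xs)) ≡ length (filterᵇ (f ∘ g) xs)
  length-filterᵇ-map f g []       = refl
  length-filterᵇ-map f g (x ∷ xs) with f (g x)
  ... | true  = cong suc (length-filterᵇ-map f g xs)
  ... | false = length-filterᵇ-map f g xs

  length-filterᵇ-false : ∀ {A : Set} (xs : List A) → length (filterᵇ (λ _ → false) xs) ≡ 0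
  length-filterᵇ-false []       = refl
  length-filterᵇ-false (x ∷ xs) = length-filterᵇ-false xs

  length-filterᵇ-allSubsets : ∀ n (f : Subset (suc n) → Bool) →
    length (filterᵇ f (allSubsets (suc n)))
      ≡ length (filterᵇ (f ∘ (true ∷_)) (allSubsets n)) + length (filterᵇ (f ∘ (false ∷_)) (allSubsets n))
  length-filterᵇ-allSubsets n f = begin
    length (filterᵇ f (map (true ∷_) A ++ map (false ∷_) A))
      ≡⟨ cong length (filter-++ (T? ∘ f) (map (true ∷_) A) (map (false ∷_) A)) ⟩
    length (filterᵇ f (map (true ∷_) A) ++ filterᵇ f (map (false ∷_) A))
      ≡⟨ length-++ (filterᵇ f (map (true ∷_) A)) ⟩
    length (filterᵇ f (map (true ∷_) A)) + length (filterᵇ f (map (false ∷_) A))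
      ≡⟨ cong₂ _+_ (length-filterᵇ-map f (true ∷_) A) (length-filterᵇ-map f (false ∷_) A) ⟩
    length (filterᵇ (f ∘ (true ∷_)) A) + length (filterᵇ (f ∘ (false ∷_)) A) ∎
    where
    open ≡-Reasoning
    A = allSubsets n

  length-subsetsOf : ∀ {n} (U : Subset n) → length (filterᵇ (_⊆ᵇ U) (allSubsets n)) ≡ 2 ^ ∣ U ∣
  length-subsetsOf {zero}  []          = refl
  length-subsetsOf {suc n} (true ∷ U)  = trans (length-filterᵇ-allSubsets n (_⊆ᵇ (true ∷ U)))
    (cong₂ _+_ (length-subsetsOf U) (trans (length-subsetsOf U) (sym (+-identityʳ (2 ^ ∣ U ∣)))))
  length-subsetsOf {suc n} (false ∷ U) = trans (length-filterᵇ-allSubsets n (_⊆ᵇ (false ∷ U)))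
    (cong₂ _+_ (length-filterᵇ-false (allSubsets n)) (length-subsetsOf U))

  length-filterᵇ-⊆-≤ : ∀ {n} r (f : Subset n → Bool) U → (∀ e → T (f e) → T (e ⊆ᵇ U)) →
    length (filterᵇ f (kSubsets n r)) ≤ 2 ^ ∣ U ∣
  length-filterᵇ-⊆-≤ {n} r f U f⇒⊆U = begin
    length (filterᵇ f (kSubsets n r))
      ≤⟨ length-mono-≤ (filter⁺ (T? ∘ f) (T? ∘ (_⊆ᵇ U)) (λ { refl → f⇒⊆U _ }) (filter-⊆ _ (allSubsets n))) ⟩
    length (filterᵇ (_⊆ᵇ U) (allSubsets n))
      ≡⟨ length-subsetsOf U ⟩
    2 ^ ∣ U ∣ ∎
    where open ≤-Reasoning

  kSubsets-size : ∀ n k → All (λ S → ∣ S ∣ ≡ k) (kSubsets n k)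
  kSubsets-size n k = All.map (≡ᵇ⇒≡ _ k) (all-filter (T? ∘ (λ A → ∣ A ∣ ≡ᵇ k)) (allSubsets n))

  m^k+m^[1+k]≤[1+m]^[1+k] : ∀ m k → m ^ k + m ^ suc k ≤ suc m ^ suc k
  m^k+m^[1+k]≤[1+m]^[1+k] m k =
    +-mono-≤ (^-monoˡ-≤ k (n≤1+n m)) (*-monoʳ-≤ m (^-monoˡ-≤ k (n≤1+n m)))

  length-kSubsets-≤ : ∀ n k → length (kSubsets n k) ≤ suc n ^ k
  length-kSubsets-≤ zero    zero    = ≤-refl
  length-kSubsets-≤ zero    (suc k) = z≤n
  length-kSubsets-≤ (suc n) zero    = ≤-trans
    (≤-reflexive (trans (length-filterᵇ-allSubsets n (λ A → ∣ A ∣ ≡ᵇ 0))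
                        (cong (_+ length (kSubsets n 0)) (length-filterᵇ-false (allSubsets n)))))
    (length-kSubsets-≤ n zero)
  length-kSubsets-≤ (suc n) (suc k) = ≤-trans
    (≤-reflexive (length-filterᵇ-allSubsets n (λ A → ∣ A ∣ ≡ᵇ suc k)))
    (≤-trans (+-mono-≤ (length-kSubsets-≤ n k) (length-kSubsets-≤ n (suc k)))
             (m^k+m^[1+k]≤[1+m]^[1+k] (suc n) k))

module Extensions where
  open import Data.Bool using (Bool; true; false; not; _∧_; _∨_; if_then_else_; T; T?)
  open import Data.Bool.Properties using (∧-conicalˡ; ∧-conicalʳ; ∨-zeroʳ; T-∧)
  open import Data.Fin using (Fin; zero; suc)
  open import Data.List using (List; []; _∷_; _++_; length; filterᵇ)
  open import Data.List.Relation.Binary.Sublist.Propositional using (_⊆_; []; _∷_; _∷ʳ_)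
  open import Data.List.Relation.Binary.Sublist.Propositional.Properties using (filter-⊆)
  open import Data.List.Relation.Unary.All as All using (All)
  open import Data.Nat as ℕ using (ℕ; zero; suc; _≤_; _+_; _∸_)
  import Data.Nat.Properties as ℕ
  open import Data.Product using (_×_; _,_; proj₁)
  open import Data.Rational using (ℚ; 0ℚ; 1ℚ; _*_; _-_; nonNegative) renaming (_≤_ to _≤ℚ_)
  open import Data.Rational.Properties
    using (≤-refl; ≤-trans; *-monoˡ-≤-nonNeg; *-monoʳ-≤-nonNeg; +-monoʳ-≤; neg-antimono-≤;
           module ≤-Reasoning)
  open import Data.Rational.Solver using (module +-*-Solver)
  open import Function using (_∘_)
  open import Function.Bundles using (Equivalence)
  open import Relation.Binary.PropositionalEquality
  open import Relation.Nullary using (contradiction)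
  open Rationals
  open Probability
  open BooleanSubsets
  open SubsetCounting using (length-filterᵇ-⊆-≤; kSubsets-size; length-kSubsets-≤)
  open +-*-Solver

  allPresent : ∀ {n} → List (Subset n) → Event n
  allPresent R E = all (λ x → elemᵇ x E) R

  elemᵇ-∷ : ∀ {n} (x e : Subset n) E → elemᵇ x E ≡ true → elemᵇ x (e ∷ E) ≡ true
  elemᵇ-∷ x e E x∈E = trans (cong ((x ≡ˢ e) ∨_) x∈E) (∨-zeroʳ (x ≡ˢ e))

  allPresent-∷ : ∀ {n} (R : List (Subset n)) e E → allPresent R E ≡ true → allPresent R (e ∷ E) ≡ true
  allPresent-∷ []      e E _     = refl
  allPresent-∷ (x ∷ R) e E R⊆E =
    cong₂ _∧_ (elemᵇ-∷ x e E (∧-conicalˡ _ _ R⊆E)) (allPresent-∷ R e E (∧-conicalʳ _ _ R⊆E))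

  allPresent-∷-∷ : ∀ {n} (e : Subset n) R E → allPresent R E ≡ true → allPresent (e ∷ R) (e ∷ E) ≡ true
  allPresent-∷-∷ e R E R⊆E = cong₂ _∧_ (cong (_∨ elemᵇ e E) (≡ˢ-refl e)) (allPresent-∷ R e E R⊆E)

  Pr-allPresent-≥ : ∀ {n} {p : ℚ} → 0ℚ ≤ℚ p → p ≤ℚ 1ℚ → ∀ {R es : List (Subset n)} →
    R ⊆ es → p ^ length R ≤ℚ Pr p es (allPresent R)
  Pr-allPresent-≥ 0≤p p≤1 [] = ≤-refl
  Pr-allPresent-≥ {p = p} 0≤p p≤1 {R} {e ∷ es} (e ∷ʳ R⊆es) = begin
    p ^ length R
      ≤⟨ Pr-allPresent-≥ 0≤p p≤1 R⊆es ⟩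
    Pr p es (allPresent R)
      ≤⟨ mix-≥ 0≤p p≤1 (Pr-mono 0≤p p≤1 es (allPresent R) (allPresent R ∘ (e ∷_)) (allPresent-∷ R e)) ≤-refl ⟩
    mix p (Pr p es (allPresent R ∘ (e ∷_))) (Pr p es (allPresent R))
      ≡⟨ sym (Pr-∷ p e es (allPresent R)) ⟩
    Pr p (e ∷ es) (allPresent R) ∎
    where open ≤-Reasoning
  Pr-allPresent-≥ {p = p} 0≤p p≤1 {e ∷ R} {e ∷ es} (refl ∷ R⊆es) = begin
    p * p ^ length R
      ≤⟨ *-monoˡ-≤-nonNeg p {{nonNegative 0≤p}} (Pr-allPresent-≥ 0≤p p≤1 R⊆es) ⟩
    p * Pr p es (allPresent R)
      ≡⟨ solve 2 (λ p a → p :* a := p :* a :+ (con 1ℚ :- p) :* con 0ℚ) refl p (Pr p es (allPresent R)) ⟩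
    mix p (Pr p es (allPresent R)) 0ℚ
      ≤⟨ mix-mono-≤ 0≤p p≤1
           (Pr-mono 0≤p p≤1 es (allPresent R) (allPresent (e ∷ R) ∘ (e ∷_)) (allPresent-∷-∷ e R))
           (Pr-nonNeg 0≤p p≤1 es (allPresent (e ∷ R))) ⟩
    mix p (Pr p es (allPresent (e ∷ R) ∘ (e ∷_))) (Pr p es (allPresent (e ∷ R)))
      ≡⟨ sym (Pr-∷ p e es (allPresent (e ∷ R))) ⟩
    Pr p (e ∷ es) (allPresent (e ∷ R)) ∎
    where open ≤-Reasoning

  required : ∀ {n} → Subset n → Subset n → Subset n → Bool
  required S A e = (e ⊆ᵇ (A ∪ S)) ∧ not (disjointᵇ e A)

  completeExtension : ∀ {n} → List (Subset n) → Subset n → Subset n → Event n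
  completeExtension L S A E = disjointᵇ S A ∧ all (λ e → if required S A e then elemᵇ e E else true) L

  someExtension : ∀ {n m} → List (Subset n) → Subset n → (Fin m → Subset n) → Event n
  someExtension {m = m} L S Q E = anyFinᵇ m (λ i → completeExtension L S (Q i) E)

  elemᵇ-ignores : ∀ {n} (y x : Subset n) E₁ E₂ → (y ≡ˢ x) ≡ false →
    elemᵇ y (E₁ ++ x ∷ E₂) ≡ elemᵇ y (E₁ ++ E₂)
  elemᵇ-ignores y x []       E₂ y≢x rewrite y≢x = refl
  elemᵇ-ignores y x (z ∷ E₁) E₂ y≢x = cong ((y ≡ˢ z) ∨_) (elemᵇ-ignores y x E₁ E₂ y≢x)

  allIf-ignores : ∀ {n} (c : Subset n → Bool) L x → c x ≡ false →
    Ignores (λ E → all (λ e → if c e then elemᵇ e E else true) L) x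
  allIf-ignores c []      x cx≡false E₁ E₂ = refl
  allIf-ignores c (e ∷ L) x cx≡false E₁ E₂ with c e in ce | e ≡ˢ x in e≡ˢx
  ... | false | _     = allIf-ignores c L x cx≡false E₁ E₂
  ... | true  | false = cong₂ _∧_ (elemᵇ-ignores e x E₁ E₂ e≡ˢx) (allIf-ignores c L x cx≡false E₁ E₂)
  ... | true  | true  with trans (sym ce) (trans (cong c (≡ˢ⇒≡ e x e≡ˢx)) cx≡false)
  ...   | ()

  allIf≡allPresent : ∀ {n} (c : Subset n → Bool) L E →
    all (λ e → if c e then elemᵇ e E else true) L ≡ allPresent (filterᵇ c L) E
  allIf≡allPresent c []      E = refl
  allIf≡allPresent c (e ∷ L) E with c e
  ... | true  = cong (elemᵇ e E ∧_) (allIf≡allPresent c L E)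
  ... | false = allIf≡allPresent c L E

  Pr-completeExtension-≥ : ∀ {n} {p : ℚ} → 0ℚ ≤ℚ p → p ≤ℚ 1ℚ → ∀ (L : List (Subset n)) S A →
    disjointᵇ S A ≡ true → p ^ length (filterᵇ (required S A) L) ≤ℚ Pr p L (completeExtension L S A)
  Pr-completeExtension-≥ {p = p} 0≤p p≤1 L S A S#A =
    subst (p ^ length (filterᵇ (required S A) L) ≤ℚ_) (Pr-cong p L allPresent≗extension)
          (Pr-allPresent-≥ 0≤p p≤1 (filter-⊆ (T? ∘ required S A) L))
    where
    allPresent≗extension : ∀ E → allPresent (filterᵇ (required S A) L) E ≡ completeExtension L S A E
    allPresent≗extension E =
      sym (trans (cong (_∧ all (λ e → if required S A e then elemᵇ e E else true) L) S#A)
                 (allIf≡allPresent (required S A) L E))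

  length-required-≤ : ∀ {n} r (S A : Subset n) →
    length (filterᵇ (required S A) (kSubsets n r)) ≤ 2 ℕ.^ (∣ A ∣ + ∣ S ∣)
  length-required-≤ r S A = ℕ.≤-trans (length-filterᵇ-⊆-≤ r (required S A) (A ∪ S) required⇒⊆)
                                      (ℕ.^-monoʳ-≤ 2 (∣p∪q∣≤∣p∣+∣q∣ A S))
    where
    required⇒⊆ : ∀ e → T (required S A e) → T (e ⊆ᵇ (A ∪ S))
    required⇒⊆ e = proj₁ ∘ Equivalence.to T-∧

  not-anyFinᵇ : ∀ m (f : Fin m → Bool) → not (anyFinᵇ m f) ≡ allFinᵇ m (not ∘ f)
  not-anyFinᵇ zero    f = refl
  not-anyFinᵇ (suc m) f with f zero
  ... | true  = refl
  ... | false = not-anyFinᵇ m (f ∘ suc)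

  module _ {n m : ℕ} (L : List (Subset n)) (S : Subset n) (Q : Fin m → Subset n)
           (Q-disjoint : PairwiseDisjoint Q) where

    support : Fin m → Subset n → Bool
    support i e = disjointᵇ S (Q i) ∧ required S (Q i) e

    ignored-outside-support : ∀ i e → support i e ≡ false → Ignores (not ∘ completeExtension L S (Q i)) e
    ignored-outside-support i e e∉ with disjointᵇ S (Q i)
    ... | false = λ _ _ → refl
    ... | true  = λ E₁ E₂ → cong not (allIf-ignores (required S (Q i)) L e e∉ E₁ E₂)

    support⇒ : ∀ i e → support i e ≡ true →
      disjointᵇ S (Q i) ≡ true × (e ⊆ᵇ (Q i ∪ S)) ≡ true × not (disjointᵇ e (Q i)) ≡ true
    support⇒ i e e∈ with disjointᵇ S (Q i) | e ⊆ᵇ (Q i ∪ S) | not (disjointᵇ e (Q i))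
    support⇒ i e refl | true | true | true = refl , refl , refl

    -- An edge required for Qⱼ lies in Qⱼ ∪ S; if S misses Qᵢ, so does Qⱼ ∪ S, and the edge cannot meet Qᵢ.
    supports-disjoint : ∀ i j e → i ≢ j → support i e ≡ true → support j e ≡ false
    supports-disjoint i j e i≢j e∈i with support j e in e∈j
    ... | false = refl
    ... | true  with support⇒ i e e∈i | support⇒ j e e∈j
    ...   | S#Qᵢ , _ , e-meets-Qᵢ | _ , e⊆Qⱼ∪S , _ =
      contradiction (trans (sym (cong not e#Qᵢ)) e-meets-Qᵢ) λ ()
      where
      e#Qᵢ : disjointᵇ e (Q i) ≡ true
      e#Qᵢ = ⊆ᵇ-∪-disjointᵇ e (Q i) (Q j) S e⊆Qⱼ∪S (Q-disjoint j i (i≢j ∘ sym)) S#Qᵢ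

    Pr-noExtension-≤ : ∀ {p} → 0ℚ ≤ℚ p → p ≤ℚ 1ℚ → ∀ c →
      (∀ i → length (filterᵇ (required S (Q i)) L) ≤ c) →
      Pr p L (not ∘ someExtension L S Q) ≤ℚ (1ℚ - p ^ c) ^ (m ∸ ∣ S ∣)
    Pr-noExtension-≤ {p} 0≤p p≤1 c few-required = begin
      Pr p L (not ∘ someExtension L S Q)
        ≡⟨ Pr-cong p L (λ E → not-anyFinᵇ m (λ i → completeExtension L S (Q i) E)) ⟩
      Pr p L (λ E → allFinᵇ m (λ i → failure i E))
        ≡⟨ Pr-allFin-independent p L m failure support ignored-outside-support supports-disjoint ⟩
      ∏ (λ i → Pr p L (failure i))
        ≤⟨ ∏-≤-^ m (λ i → Pr p L (failure i)) (λ i → disjointᵇ S (Q i))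
             (λ i → Pr-nonNeg 0≤p p≤1 L (failure i)) (λ i → Pr-≤1 0≤p p≤1 L (failure i)) Pr-failure-≤ ⟩
      (1ℚ - p ^ c) ^ ∣ blocksAvoiding S Q ∣
        ≤⟨ ^-antitoneʳ-≤ (p≤1⇒0≤1-p (^-≤1 c 0≤p p≤1)) (0≤p⇒1-p≤1 (^-nonNeg c 0≤p)) enough-blocks ⟩
      (1ℚ - p ^ c) ^ (m ∸ ∣ S ∣) ∎
      where
      open ≤-Reasoning
      failure : Fin m → Event n
      failure i = not ∘ completeExtension L S (Q i)
      Pr-failure-≤ : ∀ i → disjointᵇ S (Q i) ≡ true → Pr p L (failure i) ≤ℚ 1ℚ - p ^ c
      Pr-failure-≤ i S#Qᵢ = subst (_≤ℚ 1ℚ - p ^ c) (sym (Pr-not p L (completeExtension L S (Q i))))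
        (+-monoʳ-≤ 1ℚ (neg-antimono-≤ (≤-trans (^-antitoneʳ-≤ 0≤p p≤1 (few-required i))
                                                (Pr-completeExtension-≥ 0≤p p≤1 L S (Q i) S#Qᵢ))))
      enough-blocks : m ∸ ∣ S ∣ ≤ ∣ blocksAvoiding S Q ∣
      enough-blocks = ℕ.m≤n+o⇒m∸n≤o m ∣ S ∣
        (subst (m ≤_) (ℕ.+-comm _ ∣ S ∣) (m≤∣blocksAvoiding∣+∣S∣ m Q Q-disjoint S))

  Pr-not-goodEvent-≤ : ∀ {n m ℓ p} → 0ℚ ≤ℚ p → p ≤ℚ 1ℚ → ∀ r k (Q : Fin m → Subset n) →
    PairwiseDisjoint Q → (∀ i → ∣ Q i ∣ ≡ ℓ) →
    Pr p (kSubsets n r) (not ∘ goodEvent n r k m Q)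
      ≤ℚ fromℕ (suc n ℕ.^ k) * (1ℚ - p ^ (2 ℕ.^ (ℓ + k))) ^ (m ∸ k)
  Pr-not-goodEvent-≤ {n} {m} {ℓ} {p} 0≤p p≤1 r k Q Q-disjoint ∣Q∣≡ℓ = ≤-trans
    (Pr-not-all-≤ 0≤p p≤1 L (λ S → someExtension L S Q) (kSubsets n k)
                  (All.map Pr-noExtension-≤′ (kSubsets-size n k)))
    (*-monoʳ-≤-nonNeg _ {{nonNegative (^-nonNeg (m ∸ k) 0≤1-q)}} (fromℕ-mono-≤ (length-kSubsets-≤ n k)))
    where
    L = kSubsets n r
    c = 2 ℕ.^ (ℓ + k)
    0≤1-q = p≤1⇒0≤1-p (^-≤1 c 0≤p p≤1)
    Pr-noExtension-≤′ : ∀ {S} → ∣ S ∣ ≡ k → Pr p L (not ∘ someExtension L S Q) ≤ℚ (1ℚ - p ^ c) ^ (m ∸ k)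
    Pr-noExtension-≤′ {S} refl = Pr-noExtension-≤ L S Q Q-disjoint 0≤p p≤1 c
      (λ i → subst (λ a → length (filterᵇ (required S (Q i)) L) ≤ 2 ℕ.^ (a + k)) (∣Q∣≡ℓ i)
                   (length-required-≤ r S (Q i)))

module Growth where
  open import Data.Nat
  open import Data.Nat.Properties
  open import Data.Nat.DivMod using (_/_; _%_; m≡m%n+[m/n]*n; m%n<n; m*n/n≡m; /-monoˡ-≤)
  open import Data.Nat.Solver using (module +-*-Solver)
  open import Data.Product using (∃-syntax; _,_; proj₁; proj₂)
  open import Relation.Binary.PropositionalEquality
  open +-*-Solver

  b^t[b+t]≤b[1+b]^t : ∀ b t → b ^ t * (b + t) ≤ b * suc b ^ t
  b^t[b+t]≤b[1+b]^t b zero    = ≤-reflexive (solve 1 (λ b → con 1 :* (b :+ con 0) := b :* con 1) refl b)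
  b^t[b+t]≤b[1+b]^t b (suc t) = begin
    b ^ suc t * (b + suc t)
      ≡⟨ solve 3 (λ b t X → (b :* X) :* (b :+ (con 1 :+ t)) := X :* (b :* (b :+ t)) :+ X :* b)
                 refl b t (b ^ t) ⟩
    b ^ t * (b * (b + t)) + b ^ t * b
      ≤⟨ +-monoʳ-≤ (b ^ t * (b * (b + t))) (*-monoʳ-≤ (b ^ t) (m≤m+n b t)) ⟩
    b ^ t * (b * (b + t)) + b ^ t * (b + t)
      ≡⟨ solve 3 (λ b t X → X :* (b :* (b :+ t)) :+ X :* (b :+ t) := (con 1 :+ b) :* (X :* (b :+ t)))
                 refl b t (b ^ t) ⟩
    suc b * (b ^ t * (b + t))
      ≤⟨ *-monoʳ-≤ (suc b) (b^t[b+t]≤b[1+b]^t b t) ⟩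
    suc b * (b * suc b ^ t)
      ≡⟨ solve 2 (λ b Y → (con 1 :+ b) :* (b :* Y) := b :* ((con 1 :+ b) :* Y)) refl b (suc b ^ t) ⟩
    b * suc b ^ suc t ∎
    where open ≤-Reasoning

  2*b^b≤[1+b]^b : ∀ b .{{_ : NonZero b}} → 2 * b ^ b ≤ suc b ^ b
  2*b^b≤[1+b]^b b = *-cancelˡ-≤ b (begin
    b * (2 * b ^ b)    ≡⟨ solve 2 (λ b X → b :* (con 2 :* X) := X :* (b :+ b)) refl b (b ^ b) ⟩
    b ^ b * (b + b)    ≤⟨ b^t[b+t]≤b[1+b]^t b b ⟩
    b * suc b ^ b      ∎)
    where open ≤-Reasoning

  2^j*b^[b*j]≤[1+b]^[b*j] : ∀ b .{{_ : NonZero b}} j → 2 ^ j * b ^ (b * j) ≤ suc b ^ (b * j)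
  2^j*b^[b*j]≤[1+b]^[b*j] b zero    rewrite *-zeroʳ b = ≤-refl
  2^j*b^[b*j]≤[1+b]^[b*j] b (suc j) = begin
    2 ^ suc j * b ^ (b * suc j)
      ≡⟨ cong (λ e → 2 ^ suc j * b ^ e) (*-suc b j) ⟩
    2 ^ suc j * b ^ (b + b * j)
      ≡⟨ cong (2 ^ suc j *_) (^-distribˡ-+-* b b (b * j)) ⟩
    2 ^ suc j * (b ^ b * b ^ (b * j))
      ≡⟨ solve 3 (λ X Y Z → (con 2 :* X) :* (Y :* Z) := (con 2 :* Y) :* (X :* Z))
                 refl (2 ^ j) (b ^ b) (b ^ (b * j)) ⟩
    (2 * b ^ b) * (2 ^ j * b ^ (b * j))
      ≤⟨ *-mono-≤ (2*b^b≤[1+b]^b b) (2^j*b^[b*j]≤[1+b]^[b*j] b j) ⟩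
    suc b ^ b * suc b ^ (b * j)
      ≡⟨ sym (^-distribˡ-+-* (suc b) b (b * j)) ⟩
    suc b ^ (b + b * j)
      ≡⟨ cong (suc b ^_) (sym (*-suc b j)) ⟩
    suc b ^ (b * suc j) ∎
    where open ≤-Reasoning

  1+n≤2^n : ∀ n → suc n ≤ 2 ^ n
  1+n≤2^n zero    = ≤-refl
  1+n≤2^n (suc n) = begin
    2 + n            ≤⟨ s≤s (1+n≤2^n n) ⟩
    1 + 2 ^ n        ≤⟨ +-monoˡ-≤ (2 ^ n) (≤-trans (s≤s z≤n) (1+n≤2^n n)) ⟩
    2 ^ n + 2 ^ n    ≡⟨ cong (2 ^ n +_) (sym (+-identityʳ (2 ^ n))) ⟩
    2 ^ suc n        ∎
    where open ≤-Reasoning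

  [m*n]^k≡m^k*n^k : ∀ m n k → (m * n) ^ k ≡ m ^ k * n ^ k
  [m*n]^k≡m^k*n^k m n zero    = refl
  [m*n]^k≡m^k*n^k m n (suc k) = trans (cong ((m * n) *_) ([m*n]^k≡m^k*n^k m n k))
    (solve 4 (λ m n X Y → (m :* n) :* (X :* Y) := (m :* X) :* (n :* Y)) refl m n (m ^ k) (n ^ k))

  [1+m]≤[1+m/n]*n : ∀ m n .{{_ : NonZero n}} → suc m ≤ suc (m / n) * n
  [1+m]≤[1+m/n]*n m n = begin
    suc m                  ≡⟨ cong suc (m≡m%n+[m/n]*n m n) ⟩
    suc (m % n + m / n * n) ≤⟨ +-monoˡ-≤ (m / n * n) (m%n<n m n) ⟩
    n + m / n * n          ∎
    where open ≤-Reasoning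

  [1+u]^k*b^[b*[u*k]]≤[1+b]^[b*[u*k]] : ∀ b .{{_ : NonZero b}} u k →
    suc u ^ k * b ^ (b * (u * k)) ≤ suc b ^ (b * (u * k))
  [1+u]^k*b^[b*[u*k]]≤[1+b]^[b*[u*k]] b u k = begin
    suc u ^ k * b ^ (b * (u * k))     ≤⟨ *-monoˡ-≤ (b ^ (b * (u * k))) (^-monoˡ-≤ k (1+n≤2^n u)) ⟩
    (2 ^ u) ^ k * b ^ (b * (u * k))   ≡⟨ cong (_* b ^ (b * (u * k))) (^-*-assoc 2 u k) ⟩
    2 ^ (u * k) * b ^ (b * (u * k))   ≤⟨ 2^j*b^[b*j]≤[1+b]^[b*j] b (u * k) ⟩
    suc b ^ (b * (u * k))             ∎
    where open ≤-Reasoning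

  -- With T = b(k+1) and u = ⌊M/T⌋ we have (1+b)^M/b^M ≥ 2^(u(k+1)) ≥ (1+u)^(k+1), while
  -- C(1+M)^k ≤ C·T^k·(1+u)^k ≤ (1+u)^(k+1) once u ≥ C·T^k.
  C*[1+M]^k*b^M≤[1+b]^M : ∀ b .{{_ : NonZero b}} C k →
    ∃[ N ] ∀ M → N ≤ M → C * suc M ^ k * b ^ M ≤ suc b ^ M
  C*[1+M]^k*b^M≤[1+b]^M b C k = C * T ^ k * T , bound
    where
    T = b * suc k
    instance
      T≢0 : NonZero T
      T≢0 = m*n≢0 b (suc k)
    bound : ∀ M → C * T ^ k * T ≤ M → C * suc M ^ k * b ^ M ≤ suc b ^ M
    bound M N≤M = begin
      C * suc M ^ k * b ^ M
        ≤⟨ *-monoˡ-≤ (b ^ M) polynomial≤ ⟩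
      suc u ^ suc k * b ^ M
        ≡⟨ cong (λ e → suc u ^ suc k * b ^ e) M≡r+b*j ⟩
      suc u ^ suc k * b ^ (r + b * j)
        ≡⟨ cong (suc u ^ suc k *_) (^-distribˡ-+-* b r (b * j)) ⟩
      suc u ^ suc k * (b ^ r * b ^ (b * j))
        ≡⟨ solve 3 (λ x y z → x :* (y :* z) := y :* (x :* z)) refl (suc u ^ suc k) (b ^ r) (b ^ (b * j)) ⟩
      b ^ r * (suc u ^ suc k * b ^ (b * j))
        ≤⟨ *-mono-≤ (^-monoˡ-≤ r (n≤1+n b)) ([1+u]^k*b^[b*[u*k]]≤[1+b]^[b*[u*k]] b u (suc k)) ⟩
      suc b ^ r * suc b ^ (b * j)
        ≡⟨ sym (^-distribˡ-+-* (suc b) r (b * j)) ⟩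
      suc b ^ (r + b * j)
        ≡⟨ cong (suc b ^_) (sym M≡r+b*j) ⟩
      suc b ^ M ∎
      where
      open ≤-Reasoning
      u = M / T
      r = M % T
      j = u * suc k
      M≡r+b*j : M ≡ r + b * j
      M≡r+b*j = trans (m≡m%n+[m/n]*n M T)
        (cong (r +_) (solve 3 (λ u b k → u :* (b :* k) := b :* (u :* k)) refl u b (suc k)))
      CT^k≤u : C * T ^ k ≤ u
      CT^k≤u = subst (_≤ u) (m*n/n≡m (C * T ^ k) T) (/-monoˡ-≤ T N≤M)
      polynomial≤ : C * suc M ^ k ≤ suc u ^ suc k
      polynomial≤ = begin
        C * suc M ^ k           ≤⟨ *-monoʳ-≤ C (^-monoˡ-≤ k ([1+m]≤[1+m/n]*n M T)) ⟩
        C * (suc u * T) ^ k     ≡⟨ cong (C *_) ([m*n]^k≡m^k*n^k (suc u) T k) ⟩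
        C * (suc u ^ k * T ^ k) ≡⟨ solve 3 (λ c x y → c :* (x :* y) := c :* y :* x) refl C (suc u ^ k) (T ^ k) ⟩
        C * T ^ k * suc u ^ k   ≤⟨ *-monoˡ-≤ (suc u ^ k) (≤-trans CT^k≤u (n≤1+n u)) ⟩
        suc u ^ suc k           ∎

  E*[1+n]^k*b^[n/ℓ∸k]≤[1+b]^[n/ℓ∸k] : ∀ b .{{_ : NonZero b}} E k ℓ .{{_ : NonZero ℓ}} →
    ∃[ N ] ∀ n → N ≤ n → E * suc n ^ k * b ^ (n / ℓ ∸ k) ≤ suc b ^ (n / ℓ ∸ k)
  E*[1+n]^k*b^[n/ℓ∸k]≤[1+b]^[n/ℓ∸k] b E k ℓ = (N₀ + k) * ℓ , bound
    where
    C = E * (ℓ * suc k) ^ k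
    N₀ = proj₁ (C*[1+M]^k*b^M≤[1+b]^M b C k)
    bound : ∀ n → (N₀ + k) * ℓ ≤ n → E * suc n ^ k * b ^ (n / ℓ ∸ k) ≤ suc b ^ (n / ℓ ∸ k)
    bound n N≤n = ≤-trans (*-monoˡ-≤ (b ^ M) polynomial≤) (proj₂ (C*[1+M]^k*b^M≤[1+b]^M b C k) M N₀≤M)
      where
      M = n / ℓ ∸ k
      N₀≤M : N₀ ≤ M
      N₀≤M = m+n≤o⇒m≤o∸n N₀ (subst (_≤ n / ℓ) (m*n/n≡m (N₀ + k) ℓ) (/-monoˡ-≤ ℓ N≤n))
      1+n/ℓ≤[1+k]*[1+M] : suc (n / ℓ) ≤ suc k * suc M
      1+n/ℓ≤[1+k]*[1+M] = s≤s (begin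
        n / ℓ              ≤⟨ m≤n+m∸n (n / ℓ) k ⟩
        k + M              ≡⟨ +-comm k M ⟩
        M + k              ≤⟨ +-monoʳ-≤ M (m≤m*n k (suc M)) ⟩
        M + k * suc M      ∎)
        where open ≤-Reasoning
      polynomial≤ : E * suc n ^ k ≤ C * suc M ^ k
      polynomial≤ = begin
        E * suc n ^ k
          ≤⟨ *-monoʳ-≤ E (^-monoˡ-≤ k (≤-trans ([1+m]≤[1+m/n]*n n ℓ) (*-monoˡ-≤ ℓ 1+n/ℓ≤[1+k]*[1+M]))) ⟩
        E * (suc k * suc M * ℓ) ^ k
          ≡⟨ cong (λ x → E * x ^ k) (solve 3 (λ k m l → k :* m :* l := l :* k :* m) refl (suc k) (suc M) ℓ) ⟩
        E * (ℓ * suc k * suc M) ^ k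
          ≡⟨ cong (E *_) ([m*n]^k≡m^k*n^k (ℓ * suc k) (suc M) k) ⟩
        E * ((ℓ * suc k) ^ k * suc M ^ k)
          ≡⟨ sym (*-assoc E ((ℓ * suc k) ^ k) (suc M ^ k)) ⟩
        C * suc M ^ k ∎
        where open ≤-Reasoning

module Decay where
  open import Data.Nat as ℕ using (suc; NonZero)
  open import Data.Nat.DivMod using (_/_)
  import Data.Nat.Properties as ℕ
  open import Data.Product using (∃-syntax; _,_)
  open import Data.Rational using (0ℚ; 1ℚ; _+_; _*_; _-_; _≤_; _<_; positive; nonNegative)
  open import Data.Rational.Properties
  open import Data.Rational.Solver using (module +-*-Solver)
  open import Relation.Binary.PropositionalEquality
  open Rationals
  open Growth using (E*[1+n]^k*b^[n/ℓ∸k]≤[1+b]^[n/ℓ∸k])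
  open +-*-Solver

  [1-q][1+a]≤a : ∀ {q} → 0ℚ ≤ q → ∀ a → 1ℚ ≤ fromℕ a * q → (1ℚ - q) * fromℕ (suc a) ≤ fromℕ a
  [1-q][1+a]≤a {q} 0≤q a 1≤aq = begin
    (1ℚ - q) * (1ℚ + A)     ≡⟨ solve 2 (λ q A → (con 1ℚ :- q) :* (con 1ℚ :+ A)
                                              := (con 1ℚ :+ A) :- (q :+ A :* q)) refl q A ⟩
    (1ℚ + A) - (q + A * q)  ≤⟨ +-monoʳ-≤ (1ℚ + A) (neg-antimono-≤ (+-mono-≤ 0≤q 1≤aq)) ⟩
    (1ℚ + A) - (0ℚ + 1ℚ)    ≡⟨ solve 1 (λ A → (con 1ℚ :+ A) :- (con 0ℚ :+ con 1ℚ) := A) refl A ⟩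
    A                       ∎
    where
    open ≤-Reasoning
    A = fromℕ a

  x^M*c^M≤b^M : ∀ {x} b c M → 0ℚ ≤ x → x * fromℕ c ≤ fromℕ b → x ^ M * fromℕ (c ℕ.^ M) ≤ fromℕ (b ℕ.^ M)
  x^M*c^M≤b^M {x} b c M 0≤x xc≤b = begin
    x ^ M * fromℕ (c ℕ.^ M)  ≡⟨ cong (x ^ M *_) (fromℕ-^ c M) ⟩
    x ^ M * fromℕ c ^ M      ≡⟨ sym (^-distrib-* x (fromℕ c) M) ⟩
    (x * fromℕ c) ^ M        ≤⟨ ^-monoˡ-≤ M (*-nonNeg 0≤x (fromℕ-nonNeg c)) xc≤b ⟩
    fromℕ b ^ M              ≡⟨ sym (fromℕ-^ b M) ⟩
    fromℕ (b ℕ.^ M)          ∎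
    where open ≤-Reasoning

  E*y≤1≤E*ε⇒y≤ε : ∀ {y ε} E → 0ℚ ≤ y → 0ℚ ≤ ε → fromℕ E * y ≤ 1ℚ → 1ℚ ≤ fromℕ E * ε → y ≤ ε
  E*y≤1≤E*ε⇒y≤ε {y} {ε} E 0≤y 0≤ε Ey≤1 1≤Eε = begin
    y                  ≡⟨ sym (*-identityʳ y) ⟩
    y * 1ℚ             ≤⟨ *-monoˡ-≤-nonNeg y {{nonNegative 0≤y}} 1≤Eε ⟩
    y * (fromℕ E * ε)  ≡⟨ solve 3 (λ y e ε → y :* (e :* ε) := (e :* y) :* ε) refl y (fromℕ E) ε ⟩
    (fromℕ E * y) * ε  ≤⟨ *-monoʳ-≤-nonNeg ε {{nonNegative 0≤ε}} Ey≤1 ⟩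
    1ℚ * ε             ≡⟨ *-identityˡ ε ⟩
    ε                  ∎
    where open ≤-Reasoning

  P*x^M≤ε : ∀ {x ε} a E P M → 0ℚ ≤ x → 0ℚ ≤ ε →
    x * fromℕ (suc (suc a)) ≤ fromℕ (suc a) → 1ℚ ≤ fromℕ E * ε →
    E ℕ.* P ℕ.* suc a ℕ.^ M ℕ.≤ suc (suc a) ℕ.^ M → fromℕ P * x ^ M ≤ ε
  P*x^M≤ε {x} {ε} a E P M 0≤x 0≤ε ratio 1≤Eε dominated =
    E*y≤1≤E*ε⇒y≤ε E (*-nonNeg (fromℕ-nonNeg P) (^-nonNeg M 0≤x)) 0≤ε
      (*-cancelʳ-≤-pos Z {{positive (fromℕ-pos (suc (suc a) ℕ.^ M) {{ℕ.m^n≢0 (suc (suc a)) M}})}} (begin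
        (fromℕ E * (fromℕ P * x ^ M)) * Z
          ≡⟨ solve 4 (λ e p x z → (e :* (p :* x)) :* z := (e :* p) :* (x :* z))
                     refl (fromℕ E) (fromℕ P) (x ^ M) Z ⟩
        (fromℕ E * fromℕ P) * (x ^ M * Z)
          ≤⟨ *-monoˡ-≤-nonNeg (fromℕ E * fromℕ P) {{nonNegative (*-nonNeg (fromℕ-nonNeg E) (fromℕ-nonNeg P))}}
               (x^M*c^M≤b^M (suc a) (suc (suc a)) M 0≤x ratio) ⟩
        (fromℕ E * fromℕ P) * fromℕ (suc a ℕ.^ M)
          ≡⟨ sym (trans (fromℕ-* (E ℕ.* P) (suc a ℕ.^ M)) (cong (_* fromℕ (suc a ℕ.^ M)) (fromℕ-* E P))) ⟩
        fromℕ (E ℕ.* P ℕ.* suc a ℕ.^ M)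
          ≤⟨ fromℕ-mono-≤ dominated ⟩
        Z
          ≡⟨ sym (*-identityˡ Z) ⟩
        1ℚ * Z ∎))
      1≤Eε
    where
    open ≤-Reasoning
    Z = fromℕ (suc (suc a) ℕ.^ M)

  [1+n]^k*[1-q]^[n/ℓ∸k]→0 : ∀ {q ε} → 0ℚ < q → q ≤ 1ℚ → 0ℚ < ε → ∀ k ℓ .{{_ : NonZero ℓ}} →
    ∃[ N ] ∀ n → N ℕ.≤ n → fromℕ (suc n ℕ.^ k) * (1ℚ - q) ^ (n / ℓ ℕ.∸ k) ≤ ε
  [1+n]^k*[1-q]^[n/ℓ∸k]→0 {q} {ε} 0<q q≤1 0<ε k ℓ with archimedean q 0<q | archimedean ε 0<ε
  ... | d , 1≤dq | E , 1≤Eε with E*[1+n]^k*b^[n/ℓ∸k]≤[1+b]^[n/ℓ∸k] (suc d) E k ℓ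
  ...   | N , dominated = N , λ n N≤n →
    P*x^M≤ε d E (suc n ℕ.^ k) (n / ℓ ℕ.∸ k) (p≤1⇒0≤1-p q≤1) (<⇒≤ 0<ε) ratio 1≤Eε (dominated n N≤n)
    where
    ratio : (1ℚ - q) * fromℕ (suc (suc d)) ≤ fromℕ (suc d)
    ratio = [1-q][1+a]≤a (<⇒≤ 0<q) (suc d)
      (≤-trans 1≤dq (*-monoʳ-≤-nonNeg q {{nonNegative (<⇒≤ 0<q)}} (fromℕ-mono-≤ (ℕ.n≤1+n d))))

open import Data.Nat using (ℕ; _≤_; _+_; _∸_; NonZero)
open import Data.Nat.DivMod using (_/_)
open import Data.Fin using (Fin)
open import Data.Product using (Σ; _×_)
open import Data.Rational using (ℚ; 0ℚ; 1ℚ; _-_) renaming (_≤_ to _≤ℚ_; _<_ to _<ℚ_)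
open import Data.Fin.Subset using (Subset; ∣_∣; _∩_)
open import Data.Bool using (true)
open import Relation.Binary.PropositionalEquality using (_≡_; _≢_)

open import Data.Bool using (not)
import Data.Nat as ℕ
open import Data.Product using (_,_; proj₁; proj₂)
open import Data.Rational using (_*_)
import Data.Rational.Properties as ℚ
open import Function using (_∘_)
open Rationals using (_^_; fromℕ; ^-pos; ^-≤1)
open Probability using (Pr; Pr[¬P]≤ε⇒1-ε≤Pr[P])
open Extensions using (Pr-not-goodEvent-≤)
open Decay using ([1+n]^k*[1-q]^[n/ℓ∸k]→0)

lemma3p1 : (r s : ℕ) → 3 ≤ r → r + 1 ≤ s →
    (p : ℚ) → 0ℚ <ℚ p → p ≤ℚ 1ℚ →
    (k : ℕ) →
    .{{nz : NonZero (s ∸ r)}} →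
    (Q : (n : ℕ) → Fin (n / (s ∸ r)) → Subset n) →
    (∀ n i → ∣ Q n i ∣ ≡ s ∸ r) →
    (∀ n i j → i ≢ j → disjointᵇ (Q n i) (Q n j) ≡ true) →
    (ε : ℚ) → 0ℚ <ℚ ε →
    Σ ℕ (λ N → ∀ n → N ≤ n →
      (1ℚ - ε) ≤ℚ Prob n r p (goodEvent n r k (n / (s ∸ r)) (Q n)))
lemma3p1 r s _ _ p 0<p p≤1 k Q ∣Q∣≡ℓ Q-disjoint ε 0<ε = proj₁ decay , λ n N≤n →
  Pr[¬P]≤ε⇒1-ε≤Pr[P] p (kSubsets n r) (goodEvent n r k (n / ℓ) (Q n))
    (ℚ.≤-trans (failure≤ n) (proj₂ decay n N≤n))
  where
  ℓ = s ∸ r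
  c = 2 ℕ.^ (ℓ + k)
  failure≤ : ∀ n → Pr p (kSubsets n r) (not ∘ goodEvent n r k (n / ℓ) (Q n))
                     ≤ℚ fromℕ (ℕ.suc n ℕ.^ k) * (1ℚ - p ^ c) ^ (n / ℓ ∸ k)
  failure≤ n = Pr-not-goodEvent-≤ (ℚ.<⇒≤ 0<p) p≤1 r k (Q n) (Q-disjoint n) (∣Q∣≡ℓ n)
  decay : Σ ℕ (λ N → ∀ n → N ≤ n → fromℕ (ℕ.suc n ℕ.^ k) * (1ℚ - p ^ c) ^ (n / ℓ ∸ k) ≤ℚ ε)
  decay = [1+n]^k*[1-q]^[n/ℓ∸k]→0 (^-pos c 0<p) (^-≤1 c (ℚ.<⇒≤ 0<p) p≤1) 0<ε k ℓ
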